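{- $V(\mathbf{D}_3)=\mathrm{Mod}(\mathrm{Eq}(\mathbb{AOL})\cup\{\mathrm{SK}\})$, where (SK) is the identity $x\wedge\Diamond y\leq\Box x\vee y$; that is, the variety generated by $\mathbf{D}_3$ is axiomatised relative to the variety generated by antiortholattices by (SK) alone.
   Context: A bounded involution lattice is a bounded lattice with an order-reversing involution $'$; it is a pseudo-Kleene algebra if $a\wedge a'\leq b\vee b'$ for all $a,b$. A BZ-lattice is an algebra $\langle B,\wedge,\vee,',^{\sim},0,1\rangle$ whose $^{\sim}$-free reduct is a pseudo-Kleene algebra and which satisfies: $a\wedge a^{\sim}=0$; $a\leq a^{\sim\sim}$; $a\leq b$ implies $b^{\sim}\leq a^{\sim}$; $a^{\sim\prime}=a^{\sim\sim}$. Write $\Diamond x=x^{\sim\sim}$, $\Box x=x'^{\sim}$. A PBZ*-lattice is a BZ-lattice satisfying $(a\wedge a')^{\sim}\leq a^{\sim}\vee a'^{\sim}$ and $(a^{\sim}\vee(\Diamond a\wedge\Diamond b))\wedge\Diamond a\leq\Diamond b$. An antiortholattice is a PBZ*-lattice whose only elements $a$ with $a\wedge a'=0$ are $0$ and $1$; $\mathrm{Eq}(\mathbb{AOL})$ is the set of identities valid in all antiortholattices, and $\mathrm{Mod}(\Sigma)$ is the class of algebras satisfying $\Sigma$. $\mathbf{D}_3$ is the $3$-element chain $0<c<1$ with $0'=1$, $c'=c$, $1'=0$, $0^{\sim}=1$ and $c^{\sim}=1^{\sim}=0$. You may use that $V(\mathbf{D}_3)$ is axiomatised relative to $\mathrm{Eq}(\mathbb{AOL})$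 by (SK) together with $x\wedge(y\vee z)\approx(x\wedge y)\vee(x\wedge z)$ and $(x\wedge y)^{\sim}\approx x^{\sim}\vee y^{\sim}$ (a previously known result). -}

module Defs where

open import Level using (Level; 0ℓ; suc)
open import Data.Nat using (ℕ)
open import Data.Product using (_×_; _,_)
open import Data.Sum using (_⊎_)
open import Relation.Binary.PropositionalEquality using (_≡_)

infixr 6 _∧ₜ_
infixr 5 _∨ₜ_
data Term : Set where
  var       : ℕ → Term
  _∧ₜ_ _∨ₜ_ : Term → Term → Term
  _′ₜ _∼ₜ   : Term → Term
  0ₜ 1ₜ     : Term

record BZAlg (a : Level) : Set (suc a) where
  field
    Carrier : Set a
    _∧_ _∨_ : Carrier → Carrier → Carrier
    _′ _∼   : Carrier → Carrier
    𝟘 𝟙     : Carrier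

module _ {a : Level} (A : BZAlg a) where
  open BZAlg A

  eval : (ℕ → Carrier) → Term → Carrier
  eval ρ (var n)  = ρ n
  eval ρ (s ∧ₜ t) = eval ρ s ∧ eval ρ t
  eval ρ (s ∨ₜ t) = eval ρ s ∨ eval ρ t
  eval ρ (s ′ₜ)   = (eval ρ s) ′
  eval ρ (s ∼ₜ)   = (eval ρ s) ∼
  eval ρ 0ₜ       = 𝟘
  eval ρ 1ₜ       = 𝟙

  Sat : Term → Term → Set a
  Sat s t = ∀ (ρ : ℕ → Carrier) → eval ρ s ≡ eval ρ t

  _≤_ : Carrier → Carrier → Set a
  x ≤ y = x ∧ y ≡ x

  ◇ □ : Carrier → Carrier
  ◇ x = (x ∼) ∼
  □ x = (x ′) ∼

  record IsBoundedLattice : Set a where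
    field
      ∧-assoc : ∀ x y z → (x ∧ y) ∧ z ≡ x ∧ (y ∧ z)
      ∨-assoc : ∀ x y z → (x ∨ y) ∨ z ≡ x ∨ (y ∨ z)
      ∧-comm  : ∀ x y → x ∧ y ≡ y ∧ x
      ∨-comm  : ∀ x y → x ∨ y ≡ y ∨ x
      ∧-absorbs-∨ : ∀ x y → x ∧ (x ∨ y) ≡ x
      ∨-absorbs-∧ : ∀ x y → x ∨ (x ∧ y) ≡ x
      𝟘-least   : ∀ x → 𝟘 ≤ x
      𝟙-greatest : ∀ x → x ≤ 𝟙

  record IsBIL : Set a where
    field
      isBoundedLattice : IsBoundedLattice
      ′-involutive : ∀ x → (x ′) ′ ≡ x
      ′-antitone   : ∀ x y → x ≤ y → (y ′) ≤ (x ′)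

  record IsPKA : Set a where
    field
      isBIL  : IsBIL
      kleene : ∀ x y → (x ∧ (x ′)) ≤ (y ∨ (y ′))

  record IsBZLattice : Set a where
    field
      isPKA      : IsPKA
      ∧-∼        : ∀ x → x ∧ (x ∼) ≡ 𝟘
      ≤-∼∼       : ∀ x → x ≤ ((x ∼) ∼)
      ∼-antitone : ∀ x y → x ≤ y → (y ∼) ≤ (x ∼)
      ∼′≡∼∼      : ∀ x → ((x ∼) ′) ≡ ((x ∼) ∼)

  record IsPBZ* : Set a where
    field
      isBZLattice : IsBZLattice
      star  : ∀ x → ((x ∧ (x ′)) ∼) ≤ ((x ∼) ∨ ((x ′) ∼))
      pbz   : ∀ x y → (((x ∼) ∨ (◇ x ∧ ◇ y)) ∧ ◇ x) ≤ ◇ y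

  record IsAOL : Set a where
    field
      isPBZ*   : IsPBZ*
      onlyTrivialSharp : ∀ x → x ∧ (x ′) ≡ 𝟘 → (x ≡ 𝟘) ⊎ (x ≡ 𝟙)

EqAOL : Term → Term → Set₁
EqAOL s t = ∀ (A : BZAlg 0ℓ) → IsAOL A → Sat A s t

data D3 : Set where
  d0 dc d1 : D3

D3-∧ : D3 → D3 → D3
D3-∧ d0 y  = d0
D3-∧ dc d0 = d0
D3-∧ dc dc = dc
D3-∧ dc d1 = dc
D3-∧ d1 y  = y

D3-∨ : D3 → D3 → D3
D3-∨ d0 y  = y
D3-∨ dc d0 = dc
D3-∨ dc dc = dc
D3-∨ dc d1 = d1
D3-∨ d1 y  = d1

D3-′ : D3 → D3
D3-′ d0 = d1
D3-′ dc = dc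
D3-′ d1 = d0

D3-∼ : D3 → D3
D3-∼ d0 = d1
D3-∼ dc = d0
D3-∼ d1 = d0

𝐃₃ : BZAlg 0ℓ
𝐃₃ = record
  { Carrier = D3 ; _∧_ = D3-∧ ; _∨_ = D3-∨ ; _′ = D3-′ ; _∼ = D3-∼
  ; 𝟘 = d0 ; 𝟙 = d1 }

EqD3 : Term → Term → Set
EqD3 s t = Sat 𝐃₃ s t

-- Membership in V(𝐃₃), via Birkhoff: V(𝐃₃) = Mod(Eq(𝐃₃)).
InVD3 : ∀ {a} → BZAlg a → Set a
InVD3 A = ∀ s t → EqD3 s t → Sat A s t

InModEqAOL : ∀ {a} → BZAlg a → Set (Level._⊔_ a (suc 0ℓ))
InModEqAOL A = ∀ s t → EqAOL s t → Sat A s t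

-- (SK): x ∧ ◇y ≤ □x ∨ y, written as the identity (x ∧ ◇y) ∧ (□x ∨ y) ≈ x ∧ ◇y.
SK-lhs SK-rhs : Term
SK-lhs = (var 0 ∧ₜ ((var 1 ∼ₜ) ∼ₜ)) ∧ₜ (((var 0 ′ₜ) ∼ₜ) ∨ₜ var 1)
SK-rhs = var 0 ∧ₜ ((var 1 ∼ₜ) ∼ₜ)

SatSK : ∀ {a} → BZAlg a → Set a
SatSK A = Sat A SK-lhs SK-rhs

{-# OPTIONS --safe #-}
-- 𝐃₃ is an antiortholattice satisfying (SK), which gives one inclusion.
-- Conversely let A satisfy Eq(𝔸𝕆𝕃) and (SK).  In an antiortholattice every
-- w ∼ is 0 or 1, so A inherits the identities saying that x ≈[ w ] y, i.e.
-- w ∼ ∧ x = w ∼ ∧ y, is a congruence, and that w ∼ ∧ x is the join of its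
-- parts below (w ∨ y) ∼ and (w ∨ y ∼) ∼.  Splitting 𝟙 = 𝟘 ∼ along every
-- variable x, first by x and then by x ′, yields pieces below which x is ≈ 0,
-- ≈ 1, or has x ∼ ≈ 0 ≈ x ′ ∼ ("resembles c").  Resembling an element of 𝐃₃
-- is preserved by the operations and, thanks to (SK) in the case of c,
-- determines an element up to ≈; so a 𝐃₃-identity holds below every piece,
-- hence in A.
module Submission where

open import Defs
open import Level using (Level)
open import Data.Product using (_×_)
open import Function.Bundles using (_⇔_)

open import Data.Empty using (⊥-elim)
open import Data.Nat using (ℕ; zero; suc; _<_; _⊔_; z≤n) renaming (_≤_ to _≤ℕ_)
open import Data.Nat.Properties
  using (≤∧≢⇒<; ≤⇒≯; m⊔n≤o⇒m≤o; m⊔n≤o⇒n≤o; m≤m⊔n; m≤n⊔m) renaming (_≟_ to _≟ℕ_)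
open import Data.Product using (_,_)
open import Data.Sum using (_⊎_; inj₁; inj₂)
open import Function using (_∘_)
open import Function.Bundles using (mk⇔)
open import Relation.Binary.Bundles using (Setoid)
open import Relation.Binary.Definitions using (DecidableEquality)
open import Relation.Binary.PropositionalEquality
  using (_≡_; refl; sym; trans; cong; cong₂; subst; module ≡-Reasoning)
  renaming (setoid to ≡-setoid)
import Relation.Binary.Construct.On as On
import Relation.Binary.Reasoning.Setoid as SetoidReasoning
open import Relation.Nullary using (Dec; yes; no)
open import Relation.Nullary.Decidable using (from-yes; _→-dec_; _⊎-dec_)

module Notation {a : Level} (A : BZAlg a) where
  open BZAlg A public
    renaming (_∧_ to infixr 7 _∧_; _∨_ to infixr 6 _∨_; _′ to infix 9 _′; _∼ to infix 9 _∼)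

module BoundedLatticeProperties {a : Level} {A : BZAlg a} (L : IsBoundedLattice A) where
  open Notation A
  open IsBoundedLattice L public
  open ≡-Reasoning

  ∧-zeroˡ : ∀ x → 𝟘 ∧ x ≡ 𝟘
  ∧-zeroˡ = 𝟘-least

  ∧-zeroʳ : ∀ x → x ∧ 𝟘 ≡ 𝟘
  ∧-zeroʳ x = trans (∧-comm x 𝟘) (𝟘-least x)

  ∧-identityʳ : ∀ x → x ∧ 𝟙 ≡ x
  ∧-identityʳ = 𝟙-greatest

  ∧-identityˡ : ∀ x → 𝟙 ∧ x ≡ x
  ∧-identityˡ x = trans (∧-comm 𝟙 x) (𝟙-greatest x)

  ∧-idem : ∀ x → x ∧ x ≡ x
  ∧-idem x = begin
    x ∧ x           ≡⟨ cong (x ∧_) (∨-absorbs-∧ x x) ⟨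
    x ∧ (x ∨ x ∧ x) ≡⟨ ∧-absorbs-∨ x (x ∧ x) ⟩
    x               ∎

  ∨-idem : ∀ x → x ∨ x ≡ x
  ∨-idem x = trans (cong (x ∨_) (sym (∧-idem x))) (∨-absorbs-∧ x x)

  ∨-identityʳ : ∀ x → x ∨ 𝟘 ≡ x
  ∨-identityʳ x = trans (cong (x ∨_) (sym (∧-zeroʳ x))) (∨-absorbs-∧ x 𝟘)

  ∨-identityˡ : ∀ x → 𝟘 ∨ x ≡ x
  ∨-identityˡ x = trans (∨-comm 𝟘 x) (∨-identityʳ x)

  ∨-zeroˡ : ∀ x → 𝟙 ∨ x ≡ 𝟙
  ∨-zeroˡ x = trans (cong (𝟙 ∨_) (sym (∧-identityˡ x))) (∨-absorbs-∧ 𝟙 x)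

  ∨-zeroʳ : ∀ x → x ∨ 𝟙 ≡ 𝟙
  ∨-zeroʳ x = trans (∨-comm x 𝟙) (∨-zeroˡ x)

module InvolutionLatticeProperties {a : Level} {A : BZAlg a} (I : IsBIL A) where
  open Notation A
  open IsBIL I public
  open BoundedLatticeProperties isBoundedLattice public
  open ≡-Reasoning

  𝟘′≡𝟙 : 𝟘 ′ ≡ 𝟙
  𝟘′≡𝟙 = begin
    𝟘 ′         ≡⟨ ∧-identityˡ (𝟘 ′) ⟨
    𝟙 ∧ 𝟘 ′     ≡⟨ cong (_∧ 𝟘 ′) (′-involutive 𝟙) ⟨
    𝟙 ′ ′ ∧ 𝟘 ′ ≡⟨ ′-antitone 𝟘 (𝟙 ′) (∧-zeroˡ (𝟙 ′)) ⟩
    𝟙 ′ ′       ≡⟨ ′-involutive 𝟙 ⟩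
    𝟙           ∎

module BZLatticeProperties {a : Level} {A : BZAlg a} (Z : IsBZLattice A) where
  open Notation A
  open IsBZLattice Z public
  open IsPKA isPKA
  open InvolutionLatticeProperties isBIL public
  open ≡-Reasoning

  𝟙∼≡𝟘 : 𝟙 ∼ ≡ 𝟘
  𝟙∼≡𝟘 = trans (sym (∧-identityˡ (𝟙 ∼))) (∧-∼ 𝟙)

  𝟘∼≡𝟙 : 𝟘 ∼ ≡ 𝟙
  𝟘∼≡𝟙 = begin
    𝟘 ∼         ≡⟨ ∧-identityˡ (𝟘 ∼) ⟨
    𝟙 ∧ 𝟘 ∼     ≡⟨ cong (λ z → 𝟙 ∧ z ∼) 𝟙∼≡𝟘 ⟨
    𝟙 ∧ 𝟙 ∼ ∼   ≡⟨ ≤-∼∼ 𝟙 ⟩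
    𝟙           ∎

  ∼≡𝟙⇒≡𝟘 : ∀ {x} → x ∼ ≡ 𝟙 → x ≡ 𝟘
  ∼≡𝟙⇒≡𝟘 {x} x∼≡𝟙 = begin
    x       ≡⟨ ∧-identityʳ x ⟨
    x ∧ 𝟙   ≡⟨ cong (x ∧_) x∼≡𝟙 ⟨
    x ∧ x ∼ ≡⟨ ∧-∼ x ⟩
    𝟘       ∎

  ∼-antitone-∨ˡ : ∀ w v → (w ∨ v) ∼ ∧ w ∼ ≡ (w ∨ v) ∼
  ∼-antitone-∨ˡ w v = ∼-antitone w (w ∨ v) (∧-absorbs-∨ w v)

  ∼-∨-annihilatesʳ : ∀ w x → (w ∨ x) ∼ ∧ x ≡ (w ∨ x) ∼ ∧ 𝟘
  ∼-∨-annihilatesʳ w x = begin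
    e ∧ x            ≡⟨ cong (_∧ x) (∼-antitone x (w ∨ x) x≤w∨x) ⟨
    (e ∧ x ∼) ∧ x    ≡⟨ ∧-assoc e (x ∼) x ⟩
    e ∧ (x ∼ ∧ x)    ≡⟨ cong (e ∧_) (trans (∧-comm (x ∼) x) (∧-∼ x)) ⟩
    e ∧ 𝟘            ∎
    where
    e = (w ∨ x) ∼
    x≤w∨x : x ∧ (w ∨ x) ≡ x
    x≤w∨x = trans (cong (x ∧_) (∨-comm w x)) (∧-absorbs-∨ x w)

module AntiortholatticeProperties {a : Level} {A : BZAlg a} (O : IsAOL A) where
  open Notation A
  open IsAOL O
  open IsPBZ* isPBZ*
  open BZLatticeProperties isBZLattice public
  open ≡-Reasoning

  ∼-sharp : ∀ w → w ∼ ≡ 𝟘 ⊎ w ∼ ≡ 𝟙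
  ∼-sharp w = onlyTrivialSharp (w ∼) (trans (cong (w ∼ ∧_) (∼′≡∼∼ w)) (∧-∼ (w ∼)))

  ∼-elim : ∀ {ℓ} (P : Carrier → Set ℓ) → P 𝟘 → P 𝟙 → ∀ w → P (w ∼)
  ∼-elim P p𝟘 p𝟙 w with ∼-sharp w
  ... | inj₁ w∼≡𝟘 = subst P (sym w∼≡𝟘) p𝟘
  ... | inj₂ w∼≡𝟙 = subst P (sym w∼≡𝟙) p𝟙

  ∼∧-distrib-∨ : ∀ w x y → w ∼ ∧ (x ∨ y) ≡ w ∼ ∧ x ∨ w ∼ ∧ y
  ∼∧-distrib-∨ w x y = ∼-elim (λ e → e ∧ (x ∨ y) ≡ e ∧ x ∨ e ∧ y)
    (trans (∧-zeroˡ (x ∨ y)) (sym (trans (cong₂ _∨_ (∧-zeroˡ x) (∧-zeroˡ y)) (∨-idem 𝟘))))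
    (trans (∧-identityˡ (x ∨ y)) (sym (cong₂ _∨_ (∧-identityˡ x) (∧-identityˡ y))))
    w

  ∼∧-′ : ∀ w x → w ∼ ∧ x ′ ≡ w ∼ ∧ (w ∼ ∧ x) ′
  ∼∧-′ w x = ∼-elim (λ e → e ∧ x ′ ≡ e ∧ (e ∧ x) ′)
    (trans (∧-zeroˡ (x ′)) (sym (∧-zeroˡ _)))
    (cong (λ z → 𝟙 ∧ z ′) (sym (∧-identityˡ x)))
    w

  ∼∧-∼ : ∀ w x → w ∼ ∧ x ∼ ≡ w ∼ ∧ (w ∼ ∧ x) ∼
  ∼∧-∼ w x = ∼-elim (λ e → e ∧ x ∼ ≡ e ∧ (e ∧ x) ∼)
    (trans (∧-zeroˡ (x ∼)) (sym (∧-zeroˡ _)))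
    (cong (λ z → 𝟙 ∧ z ∼) (sym (∧-identityˡ x)))
    w

  ∼-partition : ∀ y x → x ≡ y ∼ ∧ x ∨ y ∼ ∼ ∧ x
  ∼-partition y x = ∼-elim (λ e → x ≡ e ∧ x ∨ e ∼ ∧ x)
    (sym (begin
      𝟘 ∧ x ∨ 𝟘 ∼ ∧ x ≡⟨ cong₂ (λ u v → u ∨ v ∧ x) (∧-zeroˡ x) 𝟘∼≡𝟙 ⟩
      𝟘 ∨ 𝟙 ∧ x       ≡⟨ trans (∨-identityˡ _) (∧-identityˡ x) ⟩
      x               ∎))
    (sym (begin
      𝟙 ∧ x ∨ 𝟙 ∼ ∧ x ≡⟨ cong₂ (λ u v → u ∨ v ∧ x) (∧-identityˡ x) 𝟙∼≡𝟘 ⟩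
      x ∨ 𝟘 ∧ x       ≡⟨ trans (cong (x ∨_) (∧-zeroˡ x)) (∨-identityʳ x) ⟩
      x               ∎))
    y

  ∼∧-split : ∀ w y x → w ∼ ∧ x ≡ (w ∨ y) ∼ ∧ x ∨ (w ∨ y ∼) ∼ ∧ x
  ∼∧-split w y x with ∼-sharp w
  ... | inj₁ w∼≡𝟘 = begin
    w ∼ ∧ x                              ≡⟨ trans (cong (_∧ x) w∼≡𝟘) (∧-zeroˡ x) ⟩
    𝟘                                    ≡⟨ ∨-idem 𝟘 ⟨
    𝟘 ∨ 𝟘                                ≡⟨ cong₂ _∨_ (vanishes y) (vanishes (y ∼)) ⟨
    (w ∨ y) ∼ ∧ x ∨ (w ∨ y ∼) ∼ ∧ x      ∎
    where
    vanishes : ∀ v → (w ∨ v) ∼ ∧ x ≡ 𝟘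
    vanishes v = begin
      (w ∨ v) ∼ ∧ x           ≡⟨ cong (_∧ x) (∼-antitone-∨ˡ w v) ⟨
      ((w ∨ v) ∼ ∧ w ∼) ∧ x   ≡⟨ cong (λ z → ((w ∨ v) ∼ ∧ z) ∧ x) w∼≡𝟘 ⟩
      ((w ∨ v) ∼ ∧ 𝟘) ∧ x     ≡⟨ trans (cong (_∧ x) (∧-zeroʳ _)) (∧-zeroˡ x) ⟩
      𝟘                       ∎
  ... | inj₂ w∼≡𝟙 = begin
    w ∼ ∧ x                              ≡⟨ trans (cong (_∧ x) w∼≡𝟙) (∧-identityˡ x) ⟩
    x                                    ≡⟨ ∼-partition y x ⟩
    y ∼ ∧ x ∨ y ∼ ∼ ∧ x                  ≡⟨ cong₂ (λ u v → u ∼ ∧ x ∨ v ∼ ∧ x) (w∨≡ y) (w∨≡ (y ∼)) ⟨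
    (w ∨ y) ∼ ∧ x ∨ (w ∨ y ∼) ∼ ∧ x      ∎
    where
    w∨≡ : ∀ v → w ∨ v ≡ v
    w∨≡ v = trans (cong (_∨ v) (∼≡𝟙⇒≡𝟘 w∼≡𝟙)) (∨-identityˡ v)

module 𝐃₃-Properties where
  open Notation 𝐃₃

  infix 4 _≟_
  _≟_ : DecidableEquality D3
  d0 ≟ d0 = yes refl
  d0 ≟ dc = no λ ()
  d0 ≟ d1 = no λ ()
  dc ≟ d0 = no λ ()
  dc ≟ dc = yes refl
  dc ≟ d1 = no λ ()
  d1 ≟ d0 = no λ ()
  d1 ≟ dc = no λ ()
  d1 ≟ d1 = yes refl

  ∀? : ∀ {ℓ} {P : D3 → Set ℓ} → (∀ x → Dec (P x)) → Dec (∀ x → P x)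
  ∀? P? with P? d0 | P? dc | P? d1
  ... | yes p₀ | yes pc | yes p₁ = yes λ { d0 → p₀ ; dc → pc ; d1 → p₁ }
  ... | no ¬p₀ | _      | _      = no λ p → ¬p₀ (p d0)
  ... | _      | no ¬pc | _      = no λ p → ¬pc (p dc)
  ... | _      | _      | no ¬p₁ = no λ p → ¬p₁ (p d1)

  isAOL : IsAOL 𝐃₃
  isAOL = record
    { isPBZ* = record
      { isBZLattice = record
        { isPKA = record
          { isBIL = record
            { isBoundedLattice = record
              { ∧-assoc     = from-yes (∀? λ x → ∀? λ y → ∀? λ z → (x ∧ y) ∧ z ≟ x ∧ (y ∧ z))
              ; ∨-assoc     = from-yes (∀? λ x → ∀? λ y → ∀? λ z → (x ∨ y) ∨ z ≟ x ∨ (y ∨ z))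
              ; ∧-comm      = from-yes (∀? λ x → ∀? λ y → x ∧ y ≟ y ∧ x)
              ; ∨-comm      = from-yes (∀? λ x → ∀? λ y → x ∨ y ≟ y ∨ x)
              ; ∧-absorbs-∨ = from-yes (∀? λ x → ∀? λ y → x ∧ (x ∨ y) ≟ x)
              ; ∨-absorbs-∧ = from-yes (∀? λ x → ∀? λ y → x ∨ x ∧ y ≟ x)
              ; 𝟘-least     = from-yes (∀? λ x → 𝟘 ∧ x ≟ 𝟘)
              ; 𝟙-greatest  = from-yes (∀? λ x → x ∧ 𝟙 ≟ x)
              }
            ; ′-involutive = from-yes (∀? λ x → x ′ ′ ≟ x)
            ; ′-antitone   = from-yes (∀? λ x → ∀? λ y → (x ∧ y ≟ x) →-dec (y ′ ∧ x ′ ≟ y ′))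
            }
          ; kleene = from-yes (∀? λ x → ∀? λ y → (x ∧ x ′) ∧ (y ∨ y ′) ≟ x ∧ x ′)
          }
        ; ∧-∼        = from-yes (∀? λ x → x ∧ x ∼ ≟ 𝟘)
        ; ≤-∼∼       = from-yes (∀? λ x → x ∧ x ∼ ∼ ≟ x)
        ; ∼-antitone = from-yes (∀? λ x → ∀? λ y → (x ∧ y ≟ x) →-dec (y ∼ ∧ x ∼ ≟ y ∼))
        ; ∼′≡∼∼      = from-yes (∀? λ x → x ∼ ′ ≟ x ∼ ∼)
        }
      ; star = from-yes (∀? λ x → (x ∧ x ′) ∼ ∧ (x ∼ ∨ x ′ ∼) ≟ (x ∧ x ′) ∼)
      ; pbz  = from-yes (∀? λ x → ∀? λ y →
                 ((x ∼ ∨ x ∼ ∼ ∧ y ∼ ∼) ∧ x ∼ ∼) ∧ y ∼ ∼ ≟ (x ∼ ∨ x ∼ ∼ ∧ y ∼ ∼) ∧ x ∼ ∼)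
      }
    ; onlyTrivialSharp = from-yes (∀? λ x → (x ∧ x ′ ≟ 𝟘) →-dec (x ≟ 𝟘 ⊎-dec x ≟ 𝟙))
    }

  satSK : SatSK 𝐃₃
  satSK ρ = sk (ρ 0) (ρ 1)
    where
    sk : ∀ x y → (x ∧ y ∼ ∼) ∧ (x ′ ∼ ∨ y) ≡ x ∧ y ∼ ∼
    sk = from-yes (∀? λ x → ∀? λ y → (x ∧ y ∼ ∼) ∧ (x ′ ∼ ∨ y) ≟ x ∧ y ∼ ∼)

⟨_,_,_⟩ : ∀ {a} {X : Set a} → X → X → X → ℕ → X
⟨ x , y , z ⟩ 0 = x
⟨ x , y , z ⟩ 1 = y
⟨ x , y , z ⟩ _ = z

_[_≔_] : ∀ {a} {X : Set a} → (ℕ → X) → ℕ → X → ℕ → X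
(π [ j ≔ d ]) i with i ≟ℕ j
... | yes _ = d
... | no _  = π i

varBound : Term → ℕ
varBound (var i)  = suc i
varBound (s ∧ₜ t) = varBound s ⊔ varBound t
varBound (s ∨ₜ t) = varBound s ⊔ varBound t
varBound (s ′ₜ)   = varBound s
varBound (s ∼ₜ)   = varBound s
varBound 0ₜ       = 0
varBound 1ₜ       = 0

v₀ v₁ v₂ : Term
v₀ = var 0
v₁ = var 1
v₂ = var 2

module ModelOfEqAOL {a : Level} {A : BZAlg a} (mod : InModEqAOL A) where
  open Notation A
  private module AOL = AntiortholatticeProperties

  isBoundedLattice : IsBoundedLattice A
  isBoundedLattice = record
    { ∧-assoc = λ x y z → mod ((v₀ ∧ₜ v₁) ∧ₜ v₂) (v₀ ∧ₜ (v₁ ∧ₜ v₂))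
        (λ _ O ρ → AOL.∧-assoc O (ρ 0) (ρ 1) (ρ 2)) ⟨ x , y , z ⟩
    ; ∨-assoc = λ x y z → mod ((v₀ ∨ₜ v₁) ∨ₜ v₂) (v₀ ∨ₜ (v₁ ∨ₜ v₂))
        (λ _ O ρ → AOL.∨-assoc O (ρ 0) (ρ 1) (ρ 2)) ⟨ x , y , z ⟩
    ; ∧-comm = λ x y → mod (v₀ ∧ₜ v₁) (v₁ ∧ₜ v₀)
        (λ _ O ρ → AOL.∧-comm O (ρ 0) (ρ 1)) ⟨ x , y , y ⟩
    ; ∨-comm = λ x y → mod (v₀ ∨ₜ v₁) (v₁ ∨ₜ v₀)
        (λ _ O ρ → AOL.∨-comm O (ρ 0) (ρ 1)) ⟨ x , y , y ⟩
    ; ∧-absorbs-∨ = λ x y → mod (v₀ ∧ₜ (v₀ ∨ₜ v₁)) v₀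
        (λ _ O ρ → AOL.∧-absorbs-∨ O (ρ 0) (ρ 1)) ⟨ x , y , y ⟩
    ; ∨-absorbs-∧ = λ x y → mod (v₀ ∨ₜ v₀ ∧ₜ v₁) v₀
        (λ _ O ρ → AOL.∨-absorbs-∧ O (ρ 0) (ρ 1)) ⟨ x , y , y ⟩
    ; 𝟘-least = λ x → mod (0ₜ ∧ₜ v₀) 0ₜ (λ _ O ρ → AOL.𝟘-least O (ρ 0)) ⟨ x , x , x ⟩
    ; 𝟙-greatest = λ x → mod (v₀ ∧ₜ 1ₜ) v₀ (λ _ O ρ → AOL.𝟙-greatest O (ρ 0)) ⟨ x , x , x ⟩
    }

  open BoundedLatticeProperties isBoundedLattice public

  ′-involutive : ∀ x → x ′ ′ ≡ x
  ′-involutive x = mod (v₀ ′ₜ ′ₜ) v₀ (λ _ O ρ → AOL.′-involutive O (ρ 0)) ⟨ x , x , x ⟩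

  𝟘′≡𝟙 : 𝟘 ′ ≡ 𝟙
  𝟘′≡𝟙 = mod (0ₜ ′ₜ) 1ₜ (λ _ O _ → AOL.𝟘′≡𝟙 O) ⟨ 𝟘 , 𝟘 , 𝟘 ⟩

  𝟙′≡𝟘 : 𝟙 ′ ≡ 𝟘
  𝟙′≡𝟘 = trans (cong _′ (sym 𝟘′≡𝟙)) (′-involutive 𝟘)

  𝟘∼≡𝟙 : 𝟘 ∼ ≡ 𝟙
  𝟘∼≡𝟙 = mod (0ₜ ∼ₜ) 1ₜ (λ _ O _ → AOL.𝟘∼≡𝟙 O) ⟨ 𝟘 , 𝟘 , 𝟘 ⟩

  𝟙∼≡𝟘 : 𝟙 ∼ ≡ 𝟘
  𝟙∼≡𝟘 = mod (1ₜ ∼ₜ) 0ₜ (λ _ O _ → AOL.𝟙∼≡𝟘 O) ⟨ 𝟘 , 𝟘 , 𝟘 ⟩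

  ∼-antitone-∨ˡ : ∀ w v → (w ∨ v) ∼ ∧ w ∼ ≡ (w ∨ v) ∼
  ∼-antitone-∨ˡ w v = mod ((v₀ ∨ₜ v₁) ∼ₜ ∧ₜ v₀ ∼ₜ) ((v₀ ∨ₜ v₁) ∼ₜ)
    (λ _ O ρ → AOL.∼-antitone-∨ˡ O (ρ 0) (ρ 1)) ⟨ w , v , v ⟩

  ∼-∨-annihilatesʳ : ∀ w x → (w ∨ x) ∼ ∧ x ≡ (w ∨ x) ∼ ∧ 𝟘
  ∼-∨-annihilatesʳ w x = mod ((v₀ ∨ₜ v₁) ∼ₜ ∧ₜ v₁) ((v₀ ∨ₜ v₁) ∼ₜ ∧ₜ 0ₜ)
    (λ _ O ρ → AOL.∼-∨-annihilatesʳ O (ρ 0) (ρ 1)) ⟨ w , x , x ⟩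

  ∼∧-distrib-∨ : ∀ w x y → w ∼ ∧ (x ∨ y) ≡ w ∼ ∧ x ∨ w ∼ ∧ y
  ∼∧-distrib-∨ w x y = mod (v₀ ∼ₜ ∧ₜ (v₁ ∨ₜ v₂)) (v₀ ∼ₜ ∧ₜ v₁ ∨ₜ v₀ ∼ₜ ∧ₜ v₂)
    (λ _ O ρ → AOL.∼∧-distrib-∨ O (ρ 0) (ρ 1) (ρ 2)) ⟨ w , x , y ⟩

  ∼∧-′ : ∀ w x → w ∼ ∧ x ′ ≡ w ∼ ∧ (w ∼ ∧ x) ′
  ∼∧-′ w x = mod (v₀ ∼ₜ ∧ₜ v₁ ′ₜ) (v₀ ∼ₜ ∧ₜ (v₀ ∼ₜ ∧ₜ v₁) ′ₜ)
    (λ _ O ρ → AOL.∼∧-′ O (ρ 0) (ρ 1)) ⟨ w , x , x ⟩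

  ∼∧-∼ : ∀ w x → w ∼ ∧ x ∼ ≡ w ∼ ∧ (w ∼ ∧ x) ∼
  ∼∧-∼ w x = mod (v₀ ∼ₜ ∧ₜ v₁ ∼ₜ) (v₀ ∼ₜ ∧ₜ (v₀ ∼ₜ ∧ₜ v₁) ∼ₜ)
    (λ _ O ρ → AOL.∼∧-∼ O (ρ 0) (ρ 1)) ⟨ w , x , x ⟩

  ∼∧-split : ∀ w y x → w ∼ ∧ x ≡ (w ∨ y) ∼ ∧ x ∨ (w ∨ y ∼) ∼ ∧ x
  ∼∧-split w y x = mod (v₀ ∼ₜ ∧ₜ v₂) ((v₀ ∨ₜ v₁) ∼ₜ ∧ₜ v₂ ∨ₜ (v₀ ∨ₜ v₁ ∼ₜ) ∼ₜ ∧ₜ v₂)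
    (λ _ O ρ → AOL.∼∧-split O (ρ 0) (ρ 1) (ρ 2)) ⟨ w , y , x ⟩

module SKModel {a : Level} {A : BZAlg a} (mod : InModEqAOL A) (sk : SatSK A) where
  open Notation A
  open ModelOfEqAOL mod

  infix 4 _≈[_]_
  _≈[_]_ : Carrier → Carrier → Carrier → Set a
  x ≈[ w ] y = w ∼ ∧ x ≡ w ∼ ∧ y

  ≈-setoid : Carrier → Setoid a a
  ≈-setoid w = On.setoid (≡-setoid Carrier) (w ∼ ∧_)

  module ≈-Reasoning (w : Carrier) = SetoidReasoning (≈-setoid w)

  module _ {w : Carrier} where
    open ≡-Reasoning

    ≈-refl : ∀ x → x ≈[ w ] x
    ≈-refl x = refl

    ∧-congʳ : ∀ {x x′} y → x ≈[ w ] x′ → x ∧ y ≈[ w ] x′ ∧ y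
    ∧-congʳ {x} {x′} y p = begin
      w ∼ ∧ (x ∧ y)   ≡⟨ ∧-assoc (w ∼) x y ⟨
      (w ∼ ∧ x) ∧ y   ≡⟨ cong (_∧ y) p ⟩
      (w ∼ ∧ x′) ∧ y  ≡⟨ ∧-assoc (w ∼) x′ y ⟩
      w ∼ ∧ (x′ ∧ y)  ∎

    ∧-cong : ∀ {x x′ y y′} → x ≈[ w ] x′ → y ≈[ w ] y′ → x ∧ y ≈[ w ] x′ ∧ y′
    ∧-cong {x} {x′} {y} {y′} p q = begin
      w ∼ ∧ (x ∧ y)    ≡⟨ ∧-congʳ y p ⟩
      w ∼ ∧ (x′ ∧ y)   ≡⟨ cong (w ∼ ∧_) (∧-comm x′ y) ⟩
      w ∼ ∧ (y ∧ x′)   ≡⟨ ∧-congʳ x′ q ⟩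
      w ∼ ∧ (y′ ∧ x′)  ≡⟨ cong (w ∼ ∧_) (∧-comm y′ x′) ⟩
      w ∼ ∧ (x′ ∧ y′)  ∎

    ∨-cong : ∀ {x x′ y y′} → x ≈[ w ] x′ → y ≈[ w ] y′ → x ∨ y ≈[ w ] x′ ∨ y′
    ∨-cong {x} {x′} {y} {y′} p q = begin
      w ∼ ∧ (x ∨ y)          ≡⟨ ∼∧-distrib-∨ w x y ⟩
      w ∼ ∧ x ∨ w ∼ ∧ y      ≡⟨ cong₂ _∨_ p q ⟩
      w ∼ ∧ x′ ∨ w ∼ ∧ y′    ≡⟨ ∼∧-distrib-∨ w x′ y′ ⟨
      w ∼ ∧ (x′ ∨ y′)        ∎

    ′-cong : ∀ {x y} → x ≈[ w ] y → x ′ ≈[ w ] y ′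
    ′-cong {x} {y} p = trans (∼∧-′ w x) (trans (cong (λ z → w ∼ ∧ z ′) p) (sym (∼∧-′ w y)))

    ∼-cong : ∀ {x y} → x ≈[ w ] y → x ∼ ≈[ w ] y ∼
    ∼-cong {x} {y} p = trans (∼∧-∼ w x) (trans (cong (λ z → w ∼ ∧ z ∼) p) (sym (∼∧-∼ w y)))

  Resembles : Carrier → D3 → Carrier → Set a
  Resembles w d0 x = x ≈[ w ] 𝟘
  Resembles w d1 x = x ≈[ w ] 𝟙
  Resembles w dc x = x ∼ ≈[ w ] 𝟘 × x ′ ∼ ≈[ w ] 𝟘

  module _ {w : Carrier} where
    open ≈-Reasoning w

    resembles-resp : ∀ d {x y} → x ≈[ w ] y → Resembles w d x → Resembles w d y
    resembles-resp d0 p q = trans (sym p) q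
    resembles-resp d1 p q = trans (sym p) q
    resembles-resp dc p (q , q′) = trans (sym (∼-cong p)) q , trans (sym (∼-cong (′-cong p))) q′

    -- Below w ∼ we have ◇ y ≈ 𝟙 and □ x ≈ 𝟘, so (SK) reads x ≤ y.
    sk-absorbs : ∀ {x y} → Resembles w dc x → Resembles w dc y → x ≈[ w ] x ∧ y
    sk-absorbs {x} {y} (_ , □x≈𝟘) (y∼≈𝟘 , _) = begin
      x                          ≡⟨ ∧-identityʳ x ⟨
      x ∧ 𝟙                      ≈⟨ ∧-cong (≈-refl x) ◇y≈𝟙 ⟨
      x ∧ y ∼ ∼                  ≡⟨ sk (⟨ x , y , y ⟩) ⟨
      (x ∧ y ∼ ∼) ∧ (x ′ ∼ ∨ y)  ≈⟨ ∧-cong (∧-cong (≈-refl x) ◇y≈𝟙) (∨-cong □x≈𝟘 (≈-refl y)) ⟩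
      (x ∧ 𝟙) ∧ (𝟘 ∨ y)          ≡⟨ cong₂ _∧_ (∧-identityʳ x) (∨-identityˡ y) ⟩
      x ∧ y                      ∎
      where
      ◇y≈𝟙 : y ∼ ∼ ≈[ w ] 𝟙
      ◇y≈𝟙 = trans (∼-cong y∼≈𝟘) (cong (w ∼ ∧_) 𝟘∼≡𝟙)

    resembles-unique : ∀ d {x y} → Resembles w d x → Resembles w d y → x ≈[ w ] y
    resembles-unique d0 p q = trans p (sym q)
    resembles-unique d1 p q = trans p (sym q)
    resembles-unique dc {x} {y} p q = begin
      x      ≈⟨ sk-absorbs p q ⟩
      x ∧ y  ≡⟨ ∧-comm x y ⟩
      y ∧ x  ≈⟨ sk-absorbs q p ⟨
      y      ∎

    resembles-∧ : ∀ d e {x y} → Resembles w d x → Resembles w e y → Resembles w (D3-∧ d e) (x ∧ y)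
    resembles-∧ d0 _  {x} {y} p _ = begin
      x ∧ y  ≈⟨ ∧-congʳ y p ⟩
      𝟘 ∧ y  ≡⟨ ∧-zeroˡ y ⟩
      𝟘      ∎
    resembles-∧ dc d0 {x} {y} _ q = begin
      x ∧ y  ≈⟨ ∧-cong (≈-refl x) q ⟩
      x ∧ 𝟘  ≡⟨ ∧-zeroʳ x ⟩
      𝟘      ∎
    resembles-∧ dc dc {x} {y} p q = resembles-resp dc (begin
      x      ≡⟨ ∧-idem x ⟨
      x ∧ x  ≈⟨ ∧-cong (≈-refl x) (resembles-unique dc p q) ⟩
      x ∧ y  ∎) p
    resembles-∧ dc d1 {x} {y} p q = resembles-resp dc (begin
      x      ≡⟨ ∧-identityʳ x ⟨
      x ∧ 𝟙  ≈⟨ ∧-cong (≈-refl x) q ⟨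
      x ∧ y  ∎) p
    resembles-∧ d1 e  {x} {y} p q = resembles-resp e (begin
      y      ≡⟨ ∧-identityˡ y ⟨
      𝟙 ∧ y  ≈⟨ ∧-congʳ y p ⟨
      x ∧ y  ∎) q

    resembles-∨ : ∀ d e {x y} → Resembles w d x → Resembles w e y → Resembles w (D3-∨ d e) (x ∨ y)
    resembles-∨ d0 e  {x} {y} p q = resembles-resp e (begin
      y      ≡⟨ ∨-identityˡ y ⟨
      𝟘 ∨ y  ≈⟨ ∨-cong p (≈-refl y) ⟨
      x ∨ y  ∎) q
    resembles-∨ dc d0 {x} {y} p q = resembles-resp dc (begin
      x      ≡⟨ ∨-identityʳ x ⟨
      x ∨ 𝟘  ≈⟨ ∨-cong (≈-refl x) q ⟨
      x ∨ y  ∎) p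
    resembles-∨ dc dc {x} {y} p q = resembles-resp dc (begin
      x      ≡⟨ ∨-idem x ⟨
      x ∨ x  ≈⟨ ∨-cong (≈-refl x) (resembles-unique dc p q) ⟩
      x ∨ y  ∎) p
    resembles-∨ dc d1 {x} {y} _ q = begin
      x ∨ y  ≈⟨ ∨-cong (≈-refl x) q ⟩
      x ∨ 𝟙  ≡⟨ ∨-zeroʳ x ⟩
      𝟙      ∎
    resembles-∨ d1 _  {x} {y} p _ = begin
      x ∨ y  ≈⟨ ∨-cong p (≈-refl y) ⟩
      𝟙 ∨ y  ≡⟨ ∨-zeroˡ y ⟩
      𝟙      ∎

    resembles-′ : ∀ d {x} → Resembles w d x → Resembles w (D3-′ d) (x ′)
    resembles-′ d0 p = trans (′-cong p) (cong (w ∼ ∧_) 𝟘′≡𝟙)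
    resembles-′ d1 p = trans (′-cong p) (cong (w ∼ ∧_) 𝟙′≡𝟘)
    resembles-′ dc {x} (p , p′) = p′ , trans (cong (λ z → w ∼ ∧ z ∼) (′-involutive x)) p

    resembles-∼ : ∀ d {x} → Resembles w d x → Resembles w (D3-∼ d) (x ∼)
    resembles-∼ d0 p = trans (∼-cong p) (cong (w ∼ ∧_) 𝟘∼≡𝟙)
    resembles-∼ d1 p = trans (∼-cong p) (cong (w ∼ ∧_) 𝟙∼≡𝟘)
    resembles-∼ dc (p , _) = p

    resembles-eval : ∀ {n} (π : ℕ → D3) (ρ : ℕ → Carrier) →
                     (∀ i → i < n → Resembles w (π i) (ρ i)) →
                     ∀ t → varBound t ≤ℕ n → Resembles w (eval 𝐃₃ π t) (eval A ρ t)
    resembles-eval π ρ h (var i)  b = h i b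
    resembles-eval π ρ h (s ∧ₜ t) b = resembles-∧ (eval 𝐃₃ π s) (eval 𝐃₃ π t)
      (resembles-eval π ρ h s (m⊔n≤o⇒m≤o (varBound s) (varBound t) b))
      (resembles-eval π ρ h t (m⊔n≤o⇒n≤o (varBound s) (varBound t) b))
    resembles-eval π ρ h (s ∨ₜ t) b = resembles-∨ (eval 𝐃₃ π s) (eval 𝐃₃ π t)
      (resembles-eval π ρ h s (m⊔n≤o⇒m≤o (varBound s) (varBound t) b))
      (resembles-eval π ρ h t (m⊔n≤o⇒n≤o (varBound s) (varBound t) b))
    resembles-eval π ρ h (t ′ₜ)   b = resembles-′ (eval 𝐃₃ π t) (resembles-eval π ρ h t b)
    resembles-eval π ρ h (t ∼ₜ)   b = resembles-∼ (eval 𝐃₃ π t) (resembles-eval π ρ h t b)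
    resembles-eval π ρ h 0ₜ       b = refl
    resembles-eval π ρ h 1ₜ       b = refl

  ≈-weaken : ∀ {w x y} v → x ≈[ w ] y → x ≈[ w ∨ v ] y
  ≈-weaken {w} {x} {y} v p = begin
    e ∧ x            ≡⟨ cong (_∧ x) (∼-antitone-∨ˡ w v) ⟨
    (e ∧ w ∼) ∧ x    ≡⟨ ∧-assoc e (w ∼) x ⟩
    e ∧ (w ∼ ∧ x)    ≡⟨ cong (e ∧_) p ⟩
    e ∧ (w ∼ ∧ y)    ≡⟨ ∧-assoc e (w ∼) y ⟨
    (e ∧ w ∼) ∧ y    ≡⟨ cong (_∧ y) (∼-antitone-∨ˡ w v) ⟩
    e ∧ y            ∎
    where
    open ≡-Reasoning
    e = (w ∨ v) ∼

  resembles-weaken : ∀ {w} v d {x} → Resembles w d x → Resembles (w ∨ v) d x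
  resembles-weaken v d0 = ≈-weaken v
  resembles-weaken v d1 = ≈-weaken v
  resembles-weaken v dc (p , p′) = ≈-weaken v p , ≈-weaken v p′

  ≈-split : ∀ {w a b} y → a ≈[ w ∨ y ] b → a ≈[ w ∨ y ∼ ] b → a ≈[ w ] b
  ≈-split {w} {a} {b} y p q =
    trans (∼∧-split w y a) (trans (cong₂ _∨_ p q) (sym (∼∧-split w y b)))

  -- refine d x w cuts the piece w ∼ down to where x resembles d; the three
  -- refinements come from splitting first by x and then by x ′.
  refine : D3 → Carrier → Carrier → Carrier
  refine d0 x w = w ∨ x
  refine d1 x w = (w ∨ x ∼) ∨ x ′
  refine dc x w = (w ∨ x ∼) ∨ x ′ ∼

  ≈-refine-split : ∀ {w a b} x → (∀ d → a ≈[ refine d x w ] b) → a ≈[ w ] b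
  ≈-refine-split x h = ≈-split x (h d0) (≈-split (x ′) (h d1) (h dc))

  resembles-refine : ∀ d w x → Resembles (refine d x w) d x
  resembles-refine d0 w x = ∼-∨-annihilatesʳ w x
  resembles-refine d1 w x = begin
    x      ≡⟨ ′-involutive x ⟨
    x ′ ′  ≈⟨ ′-cong (∼-∨-annihilatesʳ (w ∨ x ∼) (x ′)) ⟩
    𝟘 ′    ≡⟨ 𝟘′≡𝟙 ⟩
    𝟙      ∎
    where open ≈-Reasoning (refine d1 x w)
  resembles-refine dc w x =
    ≈-weaken (x ′ ∼) (∼-∨-annihilatesʳ w (x ∼)) , ∼-∨-annihilatesʳ (w ∨ x ∼) (x ′ ∼)

  resembles-refine-weaken : ∀ d x {w} e {y} → Resembles w e y → Resembles (refine d x w) e y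
  resembles-refine-weaken d0 x e = resembles-weaken x e
  resembles-refine-weaken d1 x e = resembles-weaken (x ′) e ∘ resembles-weaken (x ∼) e
  resembles-refine-weaken dc x e = resembles-weaken (x ′ ∼) e ∘ resembles-weaken (x ∼) e

  module _ (s t : Term) (s≈t : EqD3 s t) (ρ : ℕ → Carrier)
           {n : ℕ} (s-bound : varBound s ≤ℕ n) (t-bound : varBound t ≤ℕ n) where

    agree-below : ∀ k w (π : ℕ → D3) → (∀ i → k ≤ℕ i → i < n → Resembles w (π i) (ρ i)) →
                  eval A ρ s ≈[ w ] eval A ρ t
    agree-below zero w π h = resembles-unique (eval 𝐃₃ π t)
      (subst (λ d → Resembles w d (eval A ρ s)) (s≈t π) (resembles-eval π ρ (λ i → h i z≤n) s s-bound))
      (resembles-eval π ρ (λ i → h i z≤n) t t-bound)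
    agree-below (suc k) w π h = ≈-refine-split (ρ k) λ d →
      agree-below k (refine d (ρ k) w) (π [ k ≔ d ]) (extend d)
      where
      extend : ∀ d i → k ≤ℕ i → i < n → Resembles (refine d (ρ k) w) ((π [ k ≔ d ]) i) (ρ i)
      extend d i k≤i i<n with i ≟ℕ k
      ... | yes refl = resembles-refine d w (ρ i)
      ... | no i≢k   = resembles-refine-weaken d (ρ k) (π i) (h i (≤∧≢⇒< k≤i (i≢k ∘ sym)) i<n)

    agree : eval A ρ s ≡ eval A ρ t
    agree = begin
      eval A ρ s        ≡⟨ trans (cong (_∧ eval A ρ s) 𝟘∼≡𝟙) (∧-identityˡ _) ⟨
      𝟘 ∼ ∧ eval A ρ s  ≡⟨ agree-below n 𝟘 (λ _ → d0) (λ i n≤i i<n → ⊥-elim (≤⇒≯ n≤i i<n)) ⟩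
      𝟘 ∼ ∧ eval A ρ t  ≡⟨ trans (cong (_∧ eval A ρ t) 𝟘∼≡𝟙) (∧-identityˡ _) ⟩
      eval A ρ t        ∎
      where open ≡-Reasoning

  inVD3 : InVD3 A
  inVD3 s t s≈t ρ =
    agree s t s≈t ρ (m≤m⊔n (varBound s) (varBound t)) (m≤n⊔m (varBound s) (varBound t))

mainTheorem14 : ∀ {a : Level} (A : BZAlg a) →
    InVD3 A ⇔ (InModEqAOL A × SatSK A)
mainTheorem14 A = mk⇔
  (λ inV → eqAOL inV , inV SK-lhs SK-rhs 𝐃₃-Properties.satSK)
  (λ (mod , sk) → SKModel.inVD3 mod sk)
  where
  eqAOL : InVD3 A → InModEqAOL A
  eqAOL inV s t s≈t = inV s t (s≈t 𝐃₃ 𝐃₃-Properties.isAOL)
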